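{- For $n\ge 1$ let $$d_n(q)=\sum_{\pi\in \mathcal I^C_{2n}(321)}q^{\mathrm{des}^+(\pi)},\qquad p_n(q)=\sum_{\pi\in \mathcal I^C_{2n}(321)}q^{\mathrm{maj}^+(\pi)}$$ (and $d_0(q)=p_0(q)=1$). Then for $n\geq 2$, $$d_n(q)=2d_{n-1}(q)+(q-1)d_{n-2}(q),\qquad p_n(q)=(1+q)p_{n-1}(q)+(q^n-q)p_{n-2}(q).$$
   Context: A permutation $\pi\in\mathcal S_m$ is centrosymmetric if $\pi(i)+\pi(m+1-i)=m+1$ for all $1\le i\le m$. $\mathcal I^C_m(321)$ denotes the set of centrosymmetric involutions in $\mathcal S_m$ that avoid the pattern $321$. For $\pi\in\mathcal I^C_{2n}(321)$, $\mathrm{Des}^+(\pi)=\{i\in\{1,\dots,n\}:\pi(i)>\pi(i+1)\}$, $\mathrm{des}^+(\pi)=|\mathrm{Des}^+(\pi)|$, $\mathrm{maj}^+(\pi)=\sum_{i\in\mathrm{Des}^+(\pi)}i$. ($\mathcal I^C_0(321)$ consists of the empty permutation.) -}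

module Defs where

open import Data.Nat using (ℕ; zero; suc; _+_; _∸_; _≤?_; _<?_; _*_)
open import Data.Fin using (Fin; toℕ; opposite; _<_; _>_)
open import Data.Fin.Properties using (all?; _≟_)
open import Data.Vec using (Vec; []; _∷_; lookup)
open import Data.List using (List; []; _∷_; concatMap; map; filter; length; upTo)
open import Data.Nat.ListAction using (sum)
open import Data.Integer using (ℤ; +_; _-_) renaming (_+_ to _+ℤ_)
open import Data.Product using (_×_)
open import Relation.Binary.PropositionalEquality using (_≡_)
open import Relation.Nullary using (Dec; ¬_; yes; no)
open import Relation.Nullary.Decidable using (_×-dec_; ¬?)
import Data.Nat as ℕ

-- A permutation candidate of [m] is a word of length m over Fin m
-- (positions and values are 0-indexed: position i stands for i+1).
Word : ℕ → Set
Word m = Vec (Fin m) m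

allWords : (m k : ℕ) → List (Vec (Fin m) k)
allWords m zero    = [] ∷ []
allWords m (suc k) = concatMap (λ w → map (_∷ w) (Data.List.allFin m)) (allWords m k)
  where import Data.List

-- π is an involution (π ∘ π = id; in particular π is a permutation)
IsInvolution : ∀ {m} → Word m → Set
IsInvolution {m} π = ∀ (i : Fin m) → lookup π (lookup π i) ≡ i

-- centrosymmetric: π(i) + π(m+1-i) = m+1 (1-indexed), i.e.
-- π(i) + π(m-1-i) = m-1 in 0-indexed form
IsCentrosymmetric : ∀ {m} → Word m → Set
IsCentrosymmetric {m} π =
  ∀ (i : Fin m) → toℕ (lookup π i) + toℕ (lookup π (opposite i)) ≡ m ∸ 1

Avoids321 : ∀ {m} → Word m → Set
Avoids321 {m} π = ∀ (i j k : Fin m) →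
  ¬ ((i < j) × (j < k) × (lookup π i > lookup π j) × (lookup π j > lookup π k))

IsInvolution? : ∀ {m} (π : Word m) → Dec (IsInvolution π)
IsInvolution? π = all? (λ i → lookup π (lookup π i) ≟ i)

IsCentrosymmetric? : ∀ {m} (π : Word m) → Dec (IsCentrosymmetric π)
IsCentrosymmetric? {m} π =
  all? (λ i → toℕ (lookup π i) + toℕ (lookup π (opposite i)) ℕ.≟ m ∸ 1)

Avoids321? : ∀ {m} (π : Word m) → Dec (Avoids321 π)
Avoids321? π = all? λ i → all? λ j → all? λ k →
  ¬? ((i Data.Fin.<? j) ×-dec (j Data.Fin.<? k)
      ×-dec (lookup π j Data.Fin.<? lookup π i)
      ×-dec (lookup π k Data.Fin.<? lookup π j))
  where import Data.Fin

IsCI321 : ∀ {m} → Word m → Set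
IsCI321 π = IsInvolution π × IsCentrosymmetric π × Avoids321 π

IsCI321? : ∀ {m} (π : Word m) → Dec (IsCI321 π)
IsCI321? π = IsInvolution? π ×-dec IsCentrosymmetric? π ×-dec Avoids321? π

-- the finite set I^C_m(321), enumerated as a list (without repetition)
ICI321 : (m : ℕ) → List (Word m)
ICI321 m = filter IsCI321? (allWords m m)

-- value π(j) as a natural number (0-indexed position j; 0 out of range,
-- never used out of range below)
at : ∀ {m} → Word m → ℕ → ℕ
at {m} π j with j <? m
... | yes j<m = toℕ (lookup π (Data.Fin.fromℕ< j<m))
  where import Data.Fin
... | no _ = 0

-- Des⁺(π) for π of length 2n, as a list of 1-indexed positions i ∈ {1..n}
-- with π(i) > π(i+1)
Des⁺ : (n : ℕ) → Word (2 * n) → List ℕ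
Des⁺ n π = filter (λ i → at π i <? at π (i ∸ 1)) (Data.List.map suc (upTo n))
  where import Data.List
-- here i ranges over 1..n (1-indexed); 1-indexed π(i) is at π (i-1), and
-- π(i+1) is at π i.

des⁺ : (n : ℕ) → Word (2 * n) → ℕ
des⁺ n π = length (Des⁺ n π)

maj⁺ : (n : ℕ) → Word (2 * n) → ℕ
maj⁺ n π = sum (Des⁺ n π)

-- Polynomials in ℤ[q], represented by their coefficient functions

Poly : Set
Poly = ℕ → ℤ

-- generating polynomial Σ_{x ∈ xs} q^{stat x}: coefficient of q^k is
-- the number of x with stat x = k
genPoly : ∀ {A : Set} → (A → ℕ) → List A → Poly
genPoly stat xs k = + length (filter (λ x → stat x ℕ.≟ k) xs)

_⊕_ : Poly → Poly → Poly
(p ⊕ r) k = p k +ℤ r k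

_⊖_ : Poly → Poly → Poly
(p ⊖ r) k = p k - r k

q^_⊗_ : ℕ → Poly → Poly
(q^ j ⊗ p) k with j ℕ.≤? k
... | yes _ = p (k ∸ j)
... | no _  = + 0

d : ℕ → Poly
d n = genPoly (des⁺ n) (ICI321 (2 * n))

p : ℕ → Poly
p n = genPoly (maj⁺ n) (ICI321 (2 * n))

module Submission where

open import Defs
open import Data.Nat using (ℕ; zero; suc; pred; _+_; _∸_; _*_; _≤_; _<_; z≤n; s≤s; s≤s⁻¹; _<?_; _≤?_; _≟_)
open import Data.Nat.Properties
open import Data.Nat.Induction using (<-rec)
open import Data.Nat.ListAction using (sum)
open import Data.Nat.ListAction.Properties using (sum-++)
open import Data.Integer using (ℤ; _-_) renaming (_+_ to _+ℤ_)
import Data.Integer as ℤ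
open import Data.Integer.Properties using (pos-+)
open import Data.Integer.Solver using (module +-*-Solver)
open import Data.Bool using (Bool; true; false; _∧_; not; if_then_else_)
import Data.Bool as Bool
open import Data.Fin using (Fin; toℕ; fromℕ<; opposite)
open import Data.Fin.Properties using (toℕ-injective; toℕ<n; fromℕ<-toℕ; toℕ-fromℕ<; opposite-prop)
open import Data.Vec using (Vec; []; _∷_; lookup; tabulate)
open import Data.Vec.Properties using (lookup∘tabulate; tabulate∘lookup; tabulate-cong)
open import Data.List using (List; []; _∷_; [_]; _++_; map; filter; length; upTo; concatMap; allFin; cartesianProductWith)
open import Data.List.Properties using (filter-++; length-++; ++-identityʳ; filter-≐; filter-none; upTo-∷ʳ; map-++)
open import Data.List.Membership.Propositional using (_∈_)
open import Data.List.Membership.Propositional.Properties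
  using (∈-map⁺; ∈-map⁻; ∈-++⁺ˡ; ∈-++⁺ʳ; ∈-filter⁺; ∈-filter⁻; ∈-allFin; ∈-cartesianProductWith⁺)
open import Data.List.Membership.Propositional.Properties.WithK using (unique∧set⇒bag)
open import Data.List.Relation.Unary.Any using (here)
open import Data.List.Relation.Unary.All using (All; []; _∷_; universal)
open import Data.List.Relation.Unary.All.Properties using (map⁺; applyUpTo⁺₁)
open import Data.List.Relation.Unary.AllPairs using ([]; _∷_)
open import Data.List.Relation.Unary.Unique.Propositional using (Unique)
import Data.List.Relation.Unary.Unique.Propositional.Properties as Unique
open import Data.List.Relation.Binary.Permutation.Propositional using (_↭_)
open import Data.List.Relation.Binary.Permutation.Propositional.Properties using (↭-length; filter-↭)
open import Data.List.Relation.Binary.BagAndSetEquality using (∼bag⇒↭)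
open import Data.Product using (∃; _×_; _,_; proj₁; proj₂)
open import Data.Sum using (inj₁; inj₂)
open import Data.Empty using (⊥; ⊥-elim)
open import Function using (_∘_; _∘′_; case_of_; mk⇔)
open import Level using (0ℓ)
open import Relation.Nullary using (¬_; Dec; yes; no; does)
open import Relation.Nullary.Decidable using (_×-dec_; dec-true; dec-false)
open import Relation.Unary using (Pred; Decidable)
open import Relation.Binary.Definitions using (DecidableEquality; Tri; tri<; tri≈; tri>)
open import Relation.Binary.PropositionalEquality hiding ([_])

-- An involution in I^C_{2n}(321) is determined by its excedances among the first n positions,
-- and every set of such excedances occurs.  Given the set, read the positions as a Motzkin
-- path: an excedance is an up step, a non-excedance is a down step while some arc is open and
-- a flat step (fixed point) otherwise; the second half is the mirror image of the first.
-- Matching the k-th up step with the k-th down step gives a centrosymmetric 321-avoiding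
-- involution, and any other one with the same excedances agrees with it position by position
-- (a disagreement would create a 321 pattern).  A descent at i ≤ n occurs exactly when i is an
-- excedance and i+1 is not, position n+1 never being one.  So d_n and p_n count the binary words
-- w of length n by the number, resp. the sum of the positions, of the factors 10 in w0, and
-- splitting off the last letter of w gives the recurrences.

module _ {P : ℕ → Set} (P? : Decidable P) where

  witnessBelow : ℕ → ℕ → ℕ
  witnessBelow m d with anyUpTo? P? m
  ... | yes (r , _) = r
  ... | no _        = d

  witnessBelow-satisfies : ∀ {m} d → (∃ λ r → r < m × P r) → P (witnessBelow m d)
  witnessBelow-satisfies {m} d ∃r with anyUpTo? P? m
  ... | yes (_ , _ , Pr) = Pr
  ... | no ∄r            = ⊥-elim (∄r ∃r)

  witnessBelow-< : ∀ {m d} → d < m → witnessBelow m d < m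
  witnessBelow-< {m} d<m with anyUpTo? P? m
  ... | yes (_ , r<m , _) = r<m
  ... | no _              = d<m

unitStep-crossing : (f : ℕ → ℕ) → (∀ x → f (suc x) ≤ suc (f x)) →
  ∀ {lo hi k} → lo ≤ hi → f lo ≤ k → k < f hi →
  ∃ λ r → lo ≤ r × r < hi × f r ≡ k × f (suc r) ≡ suc k
unitStep-crossing f step {hi = zero} z≤n flo≤k k<fhi = ⊥-elim (<⇒≱ k<fhi flo≤k)
unitStep-crossing f step {lo} {suc h} {k} lo≤1+h flo≤k k<fhi = crossAt (k <? f h)
  where
  lo≤h : lo ≤ h
  lo≤h with m≤n⇒m<n∨m≡n lo≤1+h
  ... | inj₁ lo<1+h = s≤s⁻¹ lo<1+h
  ... | inj₂ refl   = ⊥-elim (<⇒≱ k<fhi flo≤k)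

  crossAt : Dec (k < f h) → ∃ λ r → lo ≤ r × r < suc h × f r ≡ k × f (suc r) ≡ suc k
  crossAt (yes k<fh) =
    let r , lo≤r , r<h , fr≡k , fsr≡sk = unitStep-crossing f step lo≤h flo≤k k<fh
    in  r , lo≤r , m<n⇒m<1+n r<h , fr≡k , fsr≡sk
  crossAt (no k≮fh) = h , lo≤h , ≤-refl , fh≡k , ≤-antisym (subst (λ x → f (suc h) ≤ suc x) fh≡k (step h)) k<fhi
    where
    fh≡k : f h ≡ k
    fh≡k = ≤-antisym (≮⇒≥ k≮fh) (s≤s⁻¹ (<-≤-trans k<fhi (step h)))

m∸n≡1+[m∸1+n] : ∀ {m n} → n < m → m ∸ n ≡ suc (m ∸ suc n)
m∸n≡1+[m∸1+n] {suc m} {zero}  _         = refl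
m∸n≡1+[m∸1+n] {suc m} {suc n} (s≤s n<m) = m∸n≡1+[m∸1+n] n<m

reflect-< : ∀ {a m} → a < m → m ∸ suc a < m
reflect-< {a} {suc m} _ = s≤s (m∸n≤m m a)

reflect-involutive : ∀ {a m} → a < m → m ∸ suc (m ∸ suc a) ≡ a
reflect-involutive {a} {m} a<m = trans (cong (m ∸_) (sym (m∸n≡1+[m∸1+n] a<m))) (m∸[m∸n]≡n (<⇒≤ a<m))

reflect-sum : ∀ {r m} → r < m → r + (m ∸ suc r) ≡ m ∸ 1
reflect-sum {m = suc m} (s≤s r≤m) = m+[n∸m]≡n r≤m

reflect-into-lower-half : ∀ {h a m} → m ≡ h + h → h ≤ a → a < m → m ∸ suc a < h
reflect-into-lower-half {h} {a} refl h≤a a<m = subst (h + h ∸ suc a <_) (m+n∸m≡n h h) (∸-monoʳ-< (s≤s h≤a) a<m)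

reflect-into-upper-half : ∀ {h a m} → m ≡ h + h → a < h → h ≤ m ∸ suc a
reflect-into-upper-half {h} {a} refl a<h = subst (_≤ h + h ∸ suc a) (m+n∸m≡n h h) (∸-monoʳ-≤ (h + h) a<h)

reflect-≤-half : ∀ {h a m} → m ≡ h + h → h ≤ a → m ∸ a ≤ h
reflect-≤-half {h} {a} refl h≤a = subst (h + h ∸ a ≤_) (m+n∸m≡n h h) (∸-monoʳ-≤ (h + h) h≤a)

-- Motzkin paths and their first-in first-out matching

data Step : Set where
  up down flat : Step

_≟ˢ_ : DecidableEquality Step
up   ≟ˢ up   = yes refl
down ≟ˢ down = yes refl
flat ≟ˢ flat = yes refl
up   ≟ˢ down = no λ ()
up   ≟ˢ flat = no λ ()
down ≟ˢ up   = no λ ()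
down ≟ˢ flat = no λ ()
flat ≟ˢ up   = no λ ()
flat ≟ˢ down = no λ ()

mirror : Step → Step
mirror up   = down
mirror down = up
mirror flat = flat

mirror-involutive : ∀ s → mirror (mirror s) ≡ s
mirror-involutive up   = refl
mirror-involutive down = refl
mirror-involutive flat = refl

mirror-injective : ∀ {s t} → mirror s ≡ mirror t → s ≡ t
mirror-injective {s} {t} e = trans (sym (mirror-involutive s)) (trans (cong mirror e) (mirror-involutive t))

occ : Step → Step → ℕ
occ s x with x ≟ˢ s
... | yes _ = 1
... | no _  = 0

occ-≡ : ∀ {s x} → x ≡ s → occ s x ≡ 1
occ-≡ {s} {x} x≡s with x ≟ˢ s
... | yes _  = refl
... | no x≢s = ⊥-elim (x≢s x≡s)

occ-≢ : ∀ {s x} → x ≢ s → occ s x ≡ 0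
occ-≢ {s} {x} x≢s with x ≟ˢ s
... | yes x≡s = ⊥-elim (x≢s x≡s)
... | no _    = refl

occ-≤1 : ∀ s x → occ s x ≤ 1
occ-≤1 s x with x ≟ˢ s
... | yes _ = ≤-refl
... | no _  = z≤n

occ-mirror : ∀ s x → occ (mirror s) (mirror x) ≡ occ s x
occ-mirror s x with x ≟ˢ s
... | yes x≡s = occ-≡ (cong mirror x≡s)
... | no x≢s  = occ-≢ (x≢s ∘′ mirror-injective)

≡⇒≢ : ∀ {x s t : Step} → x ≡ s → s ≢ t → x ≢ t
≡⇒≢ x≡s s≢t x≡t = s≢t (trans (sym x≡s) x≡t)

module Path (m : ℕ) (w : ℕ → Step) where

  count : Step → ℕ → ℕ
  count s zero    = 0
  count s (suc a) = occ s (w a) + count s a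

  count-step : ∀ s a → count s (suc a) ≤ suc (count s a)
  count-step s a = +-monoˡ-≤ (count s a) (occ-≤1 s (w a))

  count-mono : ∀ s {a b} → a ≤ b → count s a ≤ count s b
  count-mono s {b = zero} z≤n = ≤-refl
  count-mono s {a} {suc b} a≤1+b with m≤n⇒m<n∨m≡n a≤1+b
  ... | inj₁ a<1+b = ≤-trans (count-mono s (s≤s⁻¹ a<1+b)) (m≤n+m (count s b) (occ s (w b)))
  ... | inj₂ refl  = ≤-refl

  count-suc-≡ : ∀ {s a} → w a ≡ s → count s (suc a) ≡ suc (count s a)
  count-suc-≡ {s} {a} e = cong (_+ count s a) (occ-≡ e)

  count-suc-≢ : ∀ {s a} → w a ≢ s → count s (suc a) ≡ count s a
  count-suc-≢ {s} {a} ne = cong (_+ count s a) (occ-≢ ne)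

  count-strict : ∀ {s a b} → w a ≡ s → a < b → count s a < count s b
  count-strict {s} {b = b} e a<b = subst (_≤ count s b) (count-suc-≡ e) (count-mono s a<b)

  -- Position r carries the k-th step of kind s, counting from 0.
  Occ : Step → ℕ → ℕ → Set
  Occ s k r = count s r ≡ k × count s (suc r) ≡ suc k

  Occ? : ∀ s k → Decidable (Occ s k)
  Occ? s k r = (count s r ≟ k) ×-dec (count s (suc r) ≟ suc k)

  Occ⇒step : ∀ {s k r} → Occ s k r → w r ≡ s
  Occ⇒step {s} {k} {r} (cr≡k , csr≡sk) = decide (w r ≟ˢ s)
    where
    decide : Dec (w r ≡ s) → w r ≡ s
    decide (yes wr≡s) = wr≡s
    decide (no wr≢s)  = ⊥-elim (1+n≢n (trans (sym csr≡sk) (trans (count-suc-≢ wr≢s) cr≡k)))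

  step⇒Occ : ∀ {s r} → w r ≡ s → Occ s (count s r) r
  step⇒Occ e = refl , count-suc-≡ e

  Occ-before : ∀ {s k k′ r r′} → Occ s k r → Occ s k′ r′ → r < r′ → k < k′
  Occ-before {s} (_ , csr≡sk) (cr′≡k′ , _) r<r′ = subst₂ _≤_ csr≡sk cr′≡k′ (count-mono s r<r′)

  Occ-< : ∀ {s k k′ r r′} → Occ s k r → Occ s k′ r′ → k < k′ → r < r′
  Occ-< o o′ k<k′ = ≰⇒> λ r′≤r → case m≤n⇒m<n∨m≡n r′≤r of λ where
    (inj₁ r′<r) → <-asym k<k′ (Occ-before o′ o r′<r)
    (inj₂ refl) → <-irrefl (trans (sym (proj₁ o)) (proj₁ o′)) k<k′

  Occ-unique : ∀ {s k r r′} → Occ s k r → Occ s k r′ → r ≡ r′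
  Occ-unique {r = r} {r′} o o′ with <-cmp r r′
  ... | tri< r<r′ _ _ = ⊥-elim (<-irrefl refl (Occ-before o o′ r<r′))
  ... | tri≈ _ r≡r′ _ = r≡r′
  ... | tri> _ _ r′<r = ⊥-elim (<-irrefl refl (Occ-before o′ o r′<r))

  -- The k-th up step is matched with the k-th down step and a flat step with itself.  The
  -- partner is found by bounded search, defaulting to a when there is none.
  partnerOf : Step → ℕ → ℕ
  partnerOf flat a = a
  partnerOf s    a = witnessBelow (Occ? (mirror s) (count s a)) m a

  partner : ℕ → ℕ
  partner a = partnerOf (w a) a

  partner-< : ∀ {a} → a < m → partner a < m
  partner-< {a} a<m = partnerOf-< (w a)
    where
    partnerOf-< : ∀ s → partnerOf s a < m
    partnerOf-< up   = witnessBelow-< _ a<m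
    partnerOf-< down = witnessBelow-< _ a<m
    partnerOf-< flat = a<m

  partner-flat : ∀ {a} → w a ≡ flat → partner a ≡ a
  partner-flat {a} e = cong (λ s → partnerOf s a) e

  record IsAxisMotzkin : Set where
    field
      above-axis      : ∀ a → a ≤ m → count down a ≤ count up a
      flat-on-axis    : ∀ a → a < m → w a ≡ flat → count down a ≡ count up a
      down-above-axis : ∀ a → a < m → w a ≡ down → count down a < count up a
      balanced        : count down m ≡ count up m

  module Matching (axis : IsAxisMotzkin) where
    open IsAxisMotzkin axis

    downs-after-up : ∀ {a} → a < m → w a ≡ up → ∃ λ r → r < m × Occ down (count up a) r
    downs-after-up {a} a<m e =
      let r , _ , r<m , occ-r = unitStep-crossing (count down) (count-step down) (<⇒≤ a<m)
                                  (above-axis a (<⇒≤ a<m)) (<-≤-trans (count-strict e a<m) (≤-reflexive (sym balanced)))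
      in  r , r<m , occ-r

    ups-before-down : ∀ {a} → a < m → w a ≡ down → ∃ λ r → r < m × Occ up (count down a) r
    ups-before-down {a} a<m e =
      let r , _ , r<a , occ-r = unitStep-crossing (count up) (count-step up) z≤n z≤n (down-above-axis a a<m e)
      in  r , <-trans r<a a<m , occ-r

    partner-Occ : ∀ {a s} → a < m → w a ≡ s → s ≢ flat → Occ (mirror s) (count s a) (partner a)
    partner-Occ {a} {s} a<m e s≢flat =
      subst (Occ (mirror s) (count s a)) (sym (cong (λ x → partnerOf x a) e)) (partnerOf-Occ s e s≢flat)
      where
      partnerOf-Occ : ∀ s → w a ≡ s → s ≢ flat → Occ (mirror s) (count s a) (partnerOf s a)
      partnerOf-Occ up   e _      = witnessBelow-satisfies _ a (downs-after-up a<m e)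
      partnerOf-Occ down e _      = witnessBelow-satisfies _ a (ups-before-down a<m e)
      partnerOf-Occ flat _ s≢flat = ⊥-elim (s≢flat refl)

    up⇒excedance : ∀ {a} → a < m → w a ≡ up → a < partner a
    up⇒excedance {a} a<m e = ≰⇒> λ pa≤a → <-irrefl refl (≤-trans (closed-by pa≤a) (above-axis a (<⇒≤ a<m)))
      where
      closed-by : partner a ≤ a → suc (count up a) ≤ count down a
      closed-by pa≤a = subst₂ _≤_ (proj₂ (partner-Occ a<m e λ ())) (count-suc-≢ (≡⇒≢ e λ ()))
                              (count-mono down (s≤s pa≤a))

    down⇒deficiency : ∀ {a} → a < m → w a ≡ down → partner a < a
    down⇒deficiency {a} a<m e = ≰⇒> λ a≤pa →
      <⇒≱ (down-above-axis a a<m e) (subst (count up a ≤_) (proj₁ (partner-Occ a<m e λ ())) (count-mono up a≤pa))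

    ¬down⇒weak : ∀ {a} → a < m → w a ≢ down → a ≤ partner a
    ¬down⇒weak {a} a<m a≢down = by-step (w a) refl
      where
      by-step : ∀ s → w a ≡ s → a ≤ partner a
      by-step up   e = <⇒≤ (up⇒excedance a<m e)
      by-step down e = ⊥-elim (a≢down e)
      by-step flat e = ≤-reflexive (sym (partner-flat e))

    partner-involutive : ∀ {a} → a < m → partner (partner a) ≡ a
    partner-involutive {a} a<m = by-step (w a) refl
      where
      matched : ∀ {s} → w a ≡ s → s ≢ flat → partner (partner a) ≡ a
      matched {s} e s≢flat = sym (Occ-unique (step⇒Occ e) back)
        where
        o : Occ (mirror s) (count s a) (partner a)
        o = partner-Occ a<m e s≢flat
        back : Occ s (count s a) (partner (partner a))
        back = subst₂ (λ t k → Occ t k (partner (partner a))) (mirror-involutive s) (proj₁ o)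
                      (partner-Occ (partner-< a<m) (Occ⇒step o) (s≢flat ∘′ mirror-injective))

      by-step : ∀ s → w a ≡ s → partner (partner a) ≡ a
      by-step up   e = matched e λ ()
      by-step down e = matched e λ ()
      by-step flat e = trans (cong partner (partner-flat e)) (partner-flat e)

    partner-mono-same : ∀ {a b s} → a < b → b < m → w a ≡ s → w b ≡ s → s ≢ flat → partner a < partner b
    partner-mono-same a<b b<m ea eb s≢flat =
      Occ-< (partner-Occ (<-trans a<b b<m) ea s≢flat) (partner-Occ b<m eb s≢flat) (count-strict ea a<b)

    up-closes-before-flat : ∀ {a b} → a < b → b < m → w a ≡ up → w b ≡ flat → partner a < b
    up-closes-before-flat {a} {b} a<b b<m ea eb = ≰⇒> λ b≤pa →
      <-irrefl (flat-on-axis b b<m eb)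
        (≤-<-trans (subst (count down b ≤_) (proj₁ (partner-Occ (<-trans a<b b<m) ea λ ())) (count-mono down b≤pa))
                   (count-strict ea a<b))

    partner-increasing : ∀ {a b} → a < b → b < m → w a ≢ down → w b ≢ down → partner a < partner b
    partner-increasing {a} {b} a<b b<m a≢down b≢down = by-step (w a) (w b) refl refl
      where
      by-step : ∀ s t → w a ≡ s → w b ≡ t → partner a < partner b
      by-step flat _    ea _  = subst (_< partner b) (sym (partner-flat ea)) (<-≤-trans a<b (¬down⇒weak b<m b≢down))
      by-step up   up   ea eb = partner-mono-same a<b b<m ea eb λ ()
      by-step up   flat ea eb = subst (partner a <_) (sym (partner-flat eb)) (up-closes-before-flat a<b b<m ea eb)
      by-step down _    ea _  = ⊥-elim (a≢down ea)
      by-step _    down _  eb = ⊥-elim (b≢down eb)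

    inversion⇒ : ∀ {a b} → a < b → b < m → partner b < partner a → w a ≢ down × w b ≡ down
    inversion⇒ {a} {b} a<b b<m pb<pa with w a ≟ˢ down | w b ≟ˢ down
    ... | no a≢down  | yes b≡down = a≢down , b≡down
    ... | no a≢down  | no b≢down  = ⊥-elim (<-asym pb<pa (partner-increasing a<b b<m a≢down b≢down))
    ... | yes a≡down | yes b≡down = ⊥-elim (<-asym pb<pa (partner-mono-same a<b b<m a≡down b≡down λ ()))
    ... | yes a≡down | no b≢down  = ⊥-elim (<-asym pb<pa
          (<-trans (down⇒deficiency (<-trans a<b b<m) a≡down) (<-≤-trans a<b (¬down⇒weak b<m b≢down))))

    -- Both inversions would force opposite conditions on the middle step j.
    partner-avoids-321 : ∀ {i j k} → i < j → j < k → k < m →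
                         partner j < partner i → partner k < partner j → ⊥
    partner-avoids-321 i<j j<k k<m pj<pi pk<pj =
      proj₁ (inversion⇒ j<k k<m pk<pj) (proj₂ (inversion⇒ i<j (<-trans j<k k<m) pj<pi))

    flat-then-not-down : ∀ {a} → suc a < m → w a ≡ flat → w (suc a) ≢ down
    flat-then-not-down {a} sa<m ea esa = <-irrefl on-axis (down-above-axis (suc a) sa<m esa)
      where
      on-axis : count down (suc a) ≡ count up (suc a)
      on-axis = trans (count-suc-≢ (≡⇒≢ ea λ ()))
                (trans (flat-on-axis a (<-trans (n<1+n a) sa<m) ea) (sym (count-suc-≢ (≡⇒≢ ea λ ()))))

    descent⇒peak : ∀ {a} → suc a < m → partner (suc a) < partner a → w a ≡ up × w (suc a) ≡ down
    descent⇒peak {a} sa<m desc = by-step (w a) refl , sa≡down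
      where
      a≢down : w a ≢ down
      a≢down = proj₁ (inversion⇒ (n<1+n a) sa<m desc)
      sa≡down : w (suc a) ≡ down
      sa≡down = proj₂ (inversion⇒ (n<1+n a) sa<m desc)
      by-step : ∀ s → w a ≡ s → w a ≡ up
      by-step up   e = e
      by-step down e = ⊥-elim (a≢down e)
      by-step flat e = ⊥-elim (flat-then-not-down sa<m e sa≡down)

    peak⇒descent : ∀ {a} → suc a < m → w a ≡ up → w (suc a) ≡ down → partner (suc a) < partner a
    peak⇒descent {a} sa<m ea esa =
      ≤-<-trans (s≤s⁻¹ (down⇒deficiency sa<m esa)) (up⇒excedance (<-trans (n<1+n a) sa<m) ea)

  module MirrorSymmetric (symmetric : ∀ a → a < m → w (m ∸ suc a) ≡ mirror (w a)) where

    count-reflect : ∀ s t → mirror s ≡ t → ∀ {a} → a ≤ m → count s a + count t (m ∸ a) ≡ count t m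
    count-reflect s _ refl {zero}  _   = refl
    count-reflect s _ refl {suc a} a<m = begin
      (occ s (w a) + count s a) + count (mirror s) a*  ≡⟨ cong (_+ count (mirror s) a*) (+-comm (occ s (w a)) _) ⟩
      (count s a + occ s (w a)) + count (mirror s) a*  ≡⟨ +-assoc (count s a) _ _ ⟩
      count s a + (occ s (w a) + count (mirror s) a*)  ≡⟨ cong (λ x → count s a + (x + count (mirror s) a*)) reflected ⟩
      count s a + count (mirror s) (suc a*)            ≡⟨ cong (λ x → count s a + count (mirror s) x) (sym (m∸n≡1+[m∸1+n] a<m)) ⟩
      count s a + count (mirror s) (m ∸ a)             ≡⟨ count-reflect s _ refl (<⇒≤ a<m) ⟩
      count (mirror s) m                               ∎
      where
      open ≡-Reasoning
      a* : ℕ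
      a* = m ∸ suc a
      reflected : occ s (w a) ≡ occ (mirror s) (w (m ∸ suc a))
      reflected = sym (trans (cong (occ (mirror s)) (symmetric a a<m)) (occ-mirror s (w a)))

    count-total : ∀ s t → mirror s ≡ t → count s m ≡ count t m
    count-total s t st = begin
      count s m                ≡⟨ sym (+-identityʳ _) ⟩
      count s m + count t 0    ≡⟨ cong (λ x → count s m + count t x) (sym (n∸n≡0 m)) ⟩
      count s m + count t (m ∸ m) ≡⟨ count-reflect s t st ≤-refl ⟩
      count t m                ∎
      where open ≡-Reasoning

    count-reflect-swap : ∀ {a} → a ≤ m → count down a + count up (m ∸ a) ≡ count up a + count down (m ∸ a)
    count-reflect-swap a≤m =
      trans (count-reflect down up refl a≤m) (sym (trans (count-reflect up down refl a≤m) (count-total down up refl)))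

    axisMotzkin-from-half : ∀ {h} → m ≡ h + h →
      (∀ a → a ≤ h → count down a ≤ count up a) →
      (∀ a → a < h → w a ≡ flat → count down a ≡ count up a) →
      (∀ a → a < h → w a ≡ down → count down a < count up a) →
      IsAxisMotzkin
    axisMotzkin-from-half {h} m≡h+h above flat-on down-above = record
      { above-axis      = above-axis
      ; flat-on-axis    = flat-on-axis
      ; down-above-axis = down-above-axis
      ; balanced        = count-total down up refl
      }
      where
      above-axis : ∀ a → a ≤ m → count down a ≤ count up a
      above-axis a a≤m with a ≤? h
      ... | yes a≤h = above a a≤h
      ... | no  a≰h = +-cancelʳ-≤ _ _ _ (≤-trans
            (+-monoʳ-≤ (count down a) (above (m ∸ a) (reflect-≤-half m≡h+h (<⇒≤ (≰⇒> a≰h)))))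
            (≤-reflexive (count-reflect-swap a≤m)))

      module Reflected {a} (a<m : a < m) (h≤a : h ≤ a) where
        b : ℕ
        b = m ∸ suc a
        b<h : b < h
        b<h = reflect-into-lower-half m≡h+h h≤a a<m
        at-reflection : ∀ s → count s (m ∸ a) ≡ count s (suc b)
        at-reflection s = cong (count s) (m∸n≡1+[m∸1+n] a<m)
        step-at-b : ∀ {s} → w a ≡ s → w b ≡ mirror s
        step-at-b e = trans (symmetric a a<m) (cong mirror e)

      flat-on-axis : ∀ a → a < m → w a ≡ flat → count down a ≡ count up a
      flat-on-axis a a<m e with a <? h
      ... | yes a<h = flat-on a a<h e
      ... | no  a≮h = +-cancelʳ-≡ _ _ _ (trans (count-reflect-swap (<⇒≤ a<m)) (cong (count up a +_) on-axis))
        where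
        open Reflected a<m (≮⇒≥ a≮h)
        on-axis : count down (m ∸ a) ≡ count up (m ∸ a)
        on-axis = begin
          count down (m ∸ a)   ≡⟨ at-reflection down ⟩
          count down (suc b)   ≡⟨ count-suc-≢ (≡⇒≢ (step-at-b e) λ ()) ⟩
          count down b         ≡⟨ flat-on b b<h (step-at-b e) ⟩
          count up b           ≡⟨ sym (count-suc-≢ (≡⇒≢ (step-at-b e) λ ())) ⟩
          count up (suc b)     ≡⟨ sym (at-reflection up) ⟩
          count up (m ∸ a)     ∎
          where open ≡-Reasoning

      down-above-axis : ∀ a → a < m → w a ≡ down → count down a < count up a
      down-above-axis a a<m e with a <? h
      ... | yes a<h = down-above a a<h e
      ... | no  a≮h = +-cancelʳ-< _ _ _ (<-≤-trans (+-monoʳ-< (count down a) above-axis-strictly)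
                                                     (≤-reflexive (count-reflect-swap (<⇒≤ a<m))))
        where
        open Reflected a<m (≮⇒≥ a≮h)
        above-axis-strictly : count down (m ∸ a) < count up (m ∸ a)
        above-axis-strictly = subst₂ _<_
          (sym (trans (at-reflection down) (count-suc-≢ (≡⇒≢ (step-at-b e) λ ()))))
          (sym (trans (at-reflection up) (count-suc-≡ (step-at-b e))))
          (s≤s (above b (<⇒≤ b<h)))

    module _ (axis : IsAxisMotzkin) where
      open Matching axis

      partner-reflect : ∀ {a} → a < m → partner (m ∸ suc a) ≡ m ∸ suc (partner a)
      partner-reflect {a} a<m = by-step (w a) refl
        where
        a* : ℕ
        a* = m ∸ suc a

        matched : ∀ {s} → w a ≡ s → s ≢ flat → partner a* ≡ m ∸ suc (partner a)
        matched {s} e s≢flat = Occ-unique occ-partner-a* occ-r*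
          where
          r : ℕ
          r = partner a
          r<m : r < m
          r<m = partner-< a<m
          o : Occ (mirror s) (count s a) r
          o = partner-Occ a<m e s≢flat
          r*-step : w (m ∸ suc r) ≡ s
          r*-step = trans (symmetric r r<m) (trans (cong mirror (Occ⇒step o)) (mirror-involutive s))
          same-rank : count s (m ∸ suc r) ≡ count (mirror s) a*
          same-rank = +-cancelˡ-≡ (suc (count s a)) _ _ (begin
            suc (count s a) + count s (m ∸ suc r)    ≡⟨ cong (_+ count s (m ∸ suc r)) (sym (proj₂ o)) ⟩
            count (mirror s) (suc r) + count s (m ∸ suc r) ≡⟨ count-reflect (mirror s) s (mirror-involutive s) r<m ⟩
            count s m                                 ≡⟨ count-total s (mirror s) refl ⟩
            count (mirror s) m                        ≡⟨ sym (count-reflect s (mirror s) refl a<m) ⟩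
            count s (suc a) + count (mirror s) a*     ≡⟨ cong (_+ count (mirror s) a*) (count-suc-≡ e) ⟩
            suc (count s a) + count (mirror s) a*     ∎)
            where open ≡-Reasoning
          occ-r* : Occ s (count (mirror s) a*) (m ∸ suc r)
          occ-r* = subst (λ k → Occ s k (m ∸ suc r)) same-rank (step⇒Occ r*-step)
          occ-partner-a* : Occ s (count (mirror s) a*) (partner a*)
          occ-partner-a* = subst (λ t → Occ t (count (mirror s) a*) (partner a*)) (mirror-involutive s)
            (partner-Occ (reflect-< a<m) (trans (symmetric a a<m) (cong mirror e)) (s≢flat ∘′ mirror-injective))

        by-step : ∀ s → w a ≡ s → partner a* ≡ m ∸ suc (partner a)
        by-step up   e = matched e λ ()
        by-step down e = matched e λ ()
        by-step flat e = trans (partner-flat (trans (symmetric a a<m) (cong mirror e)))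
                          (cong (λ x → m ∸ suc x) (sym (partner-flat e)))

      partner-centrosymmetric : ∀ {a} → a < m → partner a + partner (m ∸ suc a) ≡ m ∸ 1
      partner-centrosymmetric a<m = trans (cong (partner _ +_) (partner-reflect a<m)) (reflect-sum (partner-< a<m))

-- Codes of the excedances in the first half

-- b ∷ c stores b at the last position n, and a code reads as 0 beyond its length.
bit : ∀ {n} → Vec Bool n → ℕ → Bool
bit []            a = false
bit {suc n} (b ∷ c) a with a ≟ n
... | yes _ = b
... | no  _ = bit c a

bit-≥ : ∀ {n} (c : Vec Bool n) {a} → n ≤ a → bit c a ≡ false
bit-≥ []                  _   = refl
bit-≥ {suc n} (b ∷ c) {a} n<a with a ≟ n
... | yes refl = ⊥-elim (<-irrefl refl n<a)
... | no  _    = bit-≥ c (<⇒≤ n<a)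

bit-last : ∀ {n} b (c : Vec Bool n) → bit (b ∷ c) n ≡ b
bit-last {n} b c with n ≟ n
... | yes _   = refl
... | no  n≢n = ⊥-elim (n≢n refl)

bit-init : ∀ {n} b (c : Vec Bool n) {a} → a < n → bit (b ∷ c) a ≡ bit c a
bit-init {n} b c {a} a<n with a ≟ n
... | yes refl = ⊥-elim (<-irrefl refl a<n)
... | no  _    = refl

bit-ext : ∀ {n} {c c′ : Vec Bool n} → (∀ {a} → a < n → bit c a ≡ bit c′ a) → c ≡ c′
bit-ext {c = []}    {[]}      _    = refl
bit-ext {c = b ∷ c} {b′ ∷ c′} same = cong₂ _∷_
  (trans (sym (bit-last b c)) (trans (same ≤-refl) (bit-last b′ c′)))
  (bit-ext λ a<n → trans (sym (bit-init b c a<n)) (trans (same (m<n⇒m<1+n a<n)) (bit-init b′ c′ a<n)))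

bit-false : ∀ {n} (c : Vec Bool n) a → bit (false ∷ c) a ≡ bit c a
bit-false {n} c a with a ≟ n
... | yes refl = sym (bit-≥ c ≤-refl)
... | no  _    = refl

descentAt : ∀ {n} → Vec Bool n → ℕ → Bool
descentAt c a = bit c a ∧ not (bit c (suc a))

tabulateBits : (ℕ → Bool) → (n : ℕ) → Vec Bool n
tabulateBits f zero    = []
tabulateBits f (suc n) = f n ∷ tabulateBits f n

bit-tabulateBits : ∀ f {n a} → a < n → bit (tabulateBits f n) a ≡ f a
bit-tabulateBits f {suc n} {a} a<1+n with a ≟ n
... | yes refl = refl
... | no  a≢n  = bit-tabulateBits f (≤∧≢⇒< (s≤s⁻¹ a<1+n) a≢n)

stepFrom : Bool → ℕ → Step
stepFrom true  _       = up
stepFrom false zero    = flat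
stepFrom false (suc _) = down

move : Step → ℕ → ℕ
move up   h = suc h
move down h = pred h
move flat h = h

module Decode {n : ℕ} (c : Vec Bool n) where

  m : ℕ
  m = 2 * n

  m≡n+n : m ≡ n + n
  m≡n+n = cong (n +_) (+-identityʳ n)

  height : ℕ → ℕ
  height zero    = 0
  height (suc a) = move (stepFrom (bit c a) (height a)) (height a)

  firstHalf : ℕ → Step
  firstHalf a = stepFrom (bit c a) (height a)

  stepAt : ∀ a → Dec (a < n) → Step
  stepAt a (yes _) = firstHalf a
  stepAt a (no _)  = mirror (firstHalf (m ∸ suc a))

  word : ℕ → Step
  word a = stepAt a (a <? n)

  word-lower : ∀ {a} → a < n → word a ≡ firstHalf a
  word-lower {a} a<n with a <? n
  ... | yes _   = refl
  ... | no  a≮n = ⊥-elim (a≮n a<n)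

  word-upper : ∀ {a} → n ≤ a → word a ≡ mirror (firstHalf (m ∸ suc a))
  word-upper {a} n≤a with a <? n
  ... | yes a<n = ⊥-elim (<⇒≱ a<n n≤a)
  ... | no  _   = refl

  word-symmetric : ∀ a → a < m → word (m ∸ suc a) ≡ mirror (word a)
  word-symmetric a a<m with a <? n
  ... | yes a<n = trans (word-upper (reflect-into-upper-half m≡n+n a<n))
                        (cong (mirror ∘′ firstHalf) (reflect-involutive a<m))
  ... | no  a≮n = trans (word-lower (reflect-into-lower-half m≡n+n (≮⇒≥ a≮n) a<m))
                        (sym (mirror-involutive _))

  open Path m word public

  count-up≡height+count-down : ∀ a → a ≤ n → count up a ≡ height a + count down a
  count-up≡height+count-down zero    _    = refl
  count-up≡height+count-down (suc a) a<n = begin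
    occ up (word a) + count up a                                  ≡⟨ cong₂ _+_ (cong (occ up) (word-lower a<n))
                                                                      (count-up≡height+count-down a (<⇒≤ a<n)) ⟩
    occ up (firstHalf a) + (height a + count down a)              ≡⟨ balance (bit c a) (height a) (count down a) ⟩
    height (suc a) + (occ down (firstHalf a) + count down a)      ≡⟨ cong (λ x → height (suc a) + (occ down x + count down a))
                                                                      (sym (word-lower a<n)) ⟩
    height (suc a) + count down (suc a)                           ∎
    where
    open ≡-Reasoning
    balance : ∀ b h x → occ up (stepFrom b h) + (h + x) ≡ move (stepFrom b h) h + (occ down (stepFrom b h) + x)
    balance true  h       x = refl
    balance false zero    x = refl
    balance false (suc h) x = sym (+-suc h x)

  n≤m : n ≤ m
  n≤m = subst (n ≤_) (sym m≡n+n) (m≤m+n n n)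

  lower<m : ∀ {a} → a < n → a < m
  lower<m a<n = <-≤-trans a<n n≤m

  lower-suc<m : ∀ {a} → a < n → suc a < m
  lower-suc<m {a} a<n = subst (suc a <_) (sym m≡n+n)
    (≤-trans (s≤s a<n) (subst (_≤ n + n) (+-comm n 1) (+-monoʳ-≤ n (≤-trans (s≤s z≤n) a<n))))

  axis : IsAxisMotzkin
  axis = MirrorSymmetric.axisMotzkin-from-half word-symmetric m≡n+n on-or-above flat-on-axis down-above-axis
    where
    on-or-above : ∀ a → a ≤ n → count down a ≤ count up a
    on-or-above a a≤n = subst (count down a ≤_) (sym (count-up≡height+count-down a a≤n)) (m≤n+m _ _)

    flat-on-axis : ∀ a → a < n → word a ≡ flat → count down a ≡ count up a
    flat-on-axis a a<n e = sym (trans (count-up≡height+count-down a (<⇒≤ a<n))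
                                      (cong (_+ count down a) (ground (bit c a) (height a) (trans (sym (word-lower a<n)) e))))
      where
      ground : ∀ b h → stepFrom b h ≡ flat → h ≡ 0
      ground false zero _ = refl

    down-above-axis : ∀ a → a < n → word a ≡ down → count down a < count up a
    down-above-axis a a<n e = subst (count down a <_) (sym (count-up≡height+count-down a (<⇒≤ a<n)))
                                    (m<n+m _ (positive (bit c a) (height a) (trans (sym (word-lower a<n)) e)))
      where
      positive : ∀ b h → stepFrom b h ≡ down → 0 < h
      positive false (suc h) _ = s≤s z≤n

  open Matching axis public

  partner-centrosymmetric : ∀ {a} → a < m → partner a + partner (m ∸ suc a) ≡ m ∸ 1
  partner-centrosymmetric = MirrorSymmetric.partner-centrosymmetric word-symmetric axis

  bit⇒up : ∀ {a} → a < n → bit c a ≡ true → word a ≡ up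
  bit⇒up {a} a<n e = trans (word-lower a<n) (cong (λ b → stepFrom b (height a)) e)

  up⇒bit : ∀ {a} → a < n → word a ≡ up → bit c a ≡ true
  up⇒bit {a} a<n e = opens (bit c a) (height a) (trans (sym (word-lower a<n)) e)
    where
    opens : ∀ b h → stepFrom b h ≡ up → b ≡ true
    opens true  _       _  = refl
    opens false zero    ()
    opens false (suc _) ()

  bit⇒excedance : ∀ {a} → a < n → bit c a ≡ true → a < partner a
  bit⇒excedance a<n e = up⇒excedance (lower<m a<n) (bit⇒up a<n e)

  excedance⇒bit : ∀ {a} → a < n → a < partner a → bit c a ≡ true
  excedance⇒bit {a} a<n a<pa = by-step (word a) refl
    where
    by-step : ∀ s → word a ≡ s → bit c a ≡ true
    by-step up   e = up⇒bit a<n e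
    by-step down e = ⊥-elim (<-asym a<pa (down⇒deficiency (lower<m a<n) e))
    by-step flat e = ⊥-elim (<-irrefl (sym (partner-flat e)) a<pa)

  m∸suc-n : m ∸ suc n ≡ pred n
  m∸suc-n = trans (sym (pred[m∸n]≡m∸[1+n] m n)) (cong pred (trans (cong (_∸ n) m≡n+n) (m+n∸m≡n n n)))

  down⇒no-bit : ∀ {a} → word a ≡ down → bit c a ≡ false
  down⇒no-bit {a} e = by (a <? n)
    where
    closes : ∀ b h → stepFrom b h ≡ down → b ≡ false
    closes false _ _ = refl
    by : Dec (a < n) → bit c a ≡ false
    by (yes a<n) = closes (bit c a) (height a) (trans (sym (word-lower a<n)) e)
    by (no  a≮n) = bit-≥ c (≮⇒≥ a≮n)

  up-then-no-bit⇒down : ∀ {a} → a < n → word a ≡ up → bit c (suc a) ≡ false → word (suc a) ≡ down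
  up-then-no-bit⇒down {a} a<n ea no-bit = by (suc a <? n)
    where
    first-up : firstHalf a ≡ up
    first-up = trans (sym (word-lower a<n)) ea
    by : Dec (suc a < n) → word (suc a) ≡ down
    by (yes sa<n) = trans (word-lower sa<n) (cong₂ stepFrom no-bit (cong (λ s → move s (height a)) first-up))
    by (no  sa≮n) = begin
      word (suc a)                            ≡⟨ word-upper (≮⇒≥ sa≮n) ⟩
      mirror (firstHalf (m ∸ suc (suc a)))    ≡⟨ cong (λ x → mirror (firstHalf (m ∸ suc x))) sa≡n ⟩
      mirror (firstHalf (m ∸ suc n))          ≡⟨ cong (mirror ∘′ firstHalf) (trans m∸suc-n (cong pred (sym sa≡n))) ⟩
      mirror (firstHalf a)                    ≡⟨ cong mirror first-up ⟩
      down                                    ∎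
      where
      open ≡-Reasoning
      sa≡n : suc a ≡ n
      sa≡n = ≤-antisym a<n (≮⇒≥ sa≮n)

  descent⇒code : ∀ {a} → a < n → partner (suc a) < partner a → descentAt c a ≡ true
  descent⇒code a<n desc =
    let ea , esa = descent⇒peak (lower-suc<m a<n) desc
    in  cong₂ (λ x y → x ∧ not y) (up⇒bit a<n ea) (down⇒no-bit esa)

  code⇒descent : ∀ {a} → a < n → descentAt c a ≡ true → partner (suc a) < partner a
  code⇒descent {a} a<n code = peak⇒descent (lower-suc<m a<n) ea (up-then-no-bit⇒down a<n ea no-bit)
    where
    split : ∀ x y → (x ∧ not y) ≡ true → x ≡ true × y ≡ false
    split true false _ = refl , refl
    no-bit : bit c (suc a) ≡ false
    no-bit = proj₂ (split (bit c a) (bit c (suc a)) code)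
    ea : word a ≡ up
    ea = bit⇒up a<n (proj₁ (split (bit c a) (bit c (suc a)) code))

-- Excedances determine a centrosymmetric 321-avoiding involution

record IsCI321Map (m : ℕ) (f : ℕ → ℕ) : Set where
  field
    bounded         : ∀ {a} → a < m → f a < m
    involutive      : ∀ {a} → a < m → f (f a) ≡ a
    centrosymmetric : ∀ {a} → a < m → f a + f (m ∸ suc a) ≡ m ∸ 1
    avoids-321      : ∀ {i j k} → i < j → j < k → k < m → f j < f i → f k < f j → ⊥

  deficiency-reflects : ∀ {a} → a < m → f a < a → m ∸ suc a < f (m ∸ suc a)
  deficiency-reflects a<m fa<a = +-cancelˡ-< _ _ _ (<-≤-trans (+-monoˡ-< _ fa<a)
    (≤-reflexive (trans (reflect-sum a<m) (sym (centrosymmetric a<m)))))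

  excedance-reflects : ∀ {a} → a < m → a < f a → f (m ∸ suc a) < m ∸ suc a
  excedance-reflects a<m a<fa = +-cancelˡ-< _ _ _ (<-≤-trans (+-monoˡ-< _ a<fa)
    (≤-reflexive (trans (centrosymmetric a<m) (sym (reflect-sum a<m)))))

module ExcedanceDetermined {h m : ℕ} (m≡h+h : m ≡ h + h) where

  -- b = f a, x = g b; each placement of x against a and b contradicts one of the hypotheses.
  no-larger-excedance : ∀ {f g} → IsCI321Map m f → IsCI321Map m g →
    (∀ {a} → a < h → a < f a → a < g a) → (∀ {a} → a < h → a < g a → a < f a) →
    ∀ {a} → a < m → (∀ {j} → j < a → f j ≡ g j) → a < f a → f a < g a → ⊥
  no-larger-excedance {f} {g} F G f⇒g g⇒f {a} a<m agree a<b b<c = place-x (<-cmp x a)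
    where
    module F = IsCI321Map F
    module G = IsCI321Map G
    b x : ℕ
    b = f a
    x = g b
    b<m : b < m
    b<m = F.bounded a<m
    fb≡a : f b ≡ a
    fb≡a = F.involutive a<m
    gx≡b : g x ≡ b
    gx≡b = G.involutive b<m

    x-after-b : b < x → ⊥
    x-after-b b<x with b <? h
    ... | yes b<h = <-asym a<b (subst (b <_) fb≡a (g⇒f b<h b<x))
    ... | no  b≮h = <-asym (f⇒g b*<h (F.deficiency-reflects b<m (subst (_< b) (sym fb≡a) a<b)))
                           (G.excedance-reflects b<m b<x)
      where
      b*<h : m ∸ suc b < h
      b*<h = reflect-into-lower-half m≡h+h (≮⇒≥ b≮h) b<m

    place-x : Tri (x < a) (x ≡ a) (a < x) → ⊥
    place-x (tri< x<a _ _) = <-irrefl (trans (sym (F.involutive (<-trans x<a a<m)))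
                                             (trans (cong f (trans (agree x<a) gx≡b)) fb≡a)) x<a
    place-x (tri≈ _ x≡a _) = <-irrefl (sym (trans (cong g (sym x≡a)) gx≡b)) b<c
    place-x (tri> _ _ a<x) with <-cmp x b
    ... | tri< x<b _ _ = G.avoids-321 a<x x<b b<m (subst (_< g a) (sym gx≡b) b<c) (subst (x <_) (sym gx≡b) x<b)
    ... | tri≈ _ x≡b _ = G.avoids-321 a<b b<c (G.bounded a<m) (subst (_< g a) (sym x≡b) b<c)
                                      (subst₂ _<_ (sym (G.involutive a<m)) (sym x≡b) a<b)
    ... | tri> _ _ b<x = x-after-b b<x

  agree-at-deficiency : ∀ {f g} → IsCI321Map m f → IsCI321Map m g →
    ∀ {a} → a < m → (∀ {j} → j < a → f j ≡ g j) → f a < a → g a ≡ f a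
  agree-at-deficiency {f} {g} F G a<m agree fa<a =
    trans (cong g (sym (trans (sym (agree fa<a)) (IsCI321Map.involutive F a<m))))
          (IsCI321Map.involutive G (<-trans fa<a a<m))

  excedance-determined : ∀ {f g} → IsCI321Map m f → IsCI321Map m g →
    (∀ {a} → a < h → a < f a → a < g a) → (∀ {a} → a < h → a < g a → a < f a) →
    ∀ {a} → a < m → f a ≡ g a
  excedance-determined {f} {g} F G f⇒g g⇒f {a} = <-rec (λ a → a < m → f a ≡ g a) step a
    where
    module F = IsCI321Map F
    module G = IsCI321Map G

    step : ∀ a → (∀ {j} → j < a → j < m → f j ≡ g j) → a < m → f a ≡ g a
    step a rec a<m = by-half (a <? h)
      where
      agree : ∀ {j} → j < a → f j ≡ g j
      agree j<a = rec j<a (<-trans j<a a<m)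

      at-fixed-point : a < h → f a ≡ a → f a ≡ g a
      at-fixed-point a<h fa≡a with <-cmp (g a) a
      ... | tri< ga<a _ _ = agree-at-deficiency G F a<m (sym ∘′ agree) ga<a
      ... | tri≈ _ ga≡a _ = trans fa≡a (sym ga≡a)
      ... | tri> _ _ a<ga = ⊥-elim (<-irrefl (sym fa≡a) (g⇒f a<h a<ga))

      by-half : Dec (a < h) → f a ≡ g a
      by-half (no a≮h) = +-cancelˡ-≡ (f a*) _ _ (begin
        f a* + f a                ≡⟨ cong (λ x → f a* + f x) (sym a**≡a) ⟩
        f a* + f (m ∸ suc a*)     ≡⟨ F.centrosymmetric a*<m ⟩
        m ∸ 1                     ≡⟨ sym (G.centrosymmetric a*<m) ⟩
        g a* + g (m ∸ suc a*)     ≡⟨ cong₂ _+_ (sym (agree a*<a)) (cong g a**≡a) ⟩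
        f a* + g a                ∎)
        where
        open ≡-Reasoning
        a* : ℕ
        a* = m ∸ suc a
        a*<a : a* < a
        a*<a = <-≤-trans (reflect-into-lower-half m≡h+h (≮⇒≥ a≮h) a<m) (≮⇒≥ a≮h)
        a*<m : a* < m
        a*<m = <-trans a*<a a<m
        a**≡a : m ∸ suc a* ≡ a
        a**≡a = reflect-involutive a<m
      by-half (yes a<h) with <-cmp a (f a)
      ... | tri< a<fa _ _ = excedance (<-cmp (f a) (g a))
        where
        excedance : Tri (f a < g a) (f a ≡ g a) (g a < f a) → f a ≡ g a
        excedance (tri< fa<ga _ _) = ⊥-elim (no-larger-excedance F G f⇒g g⇒f a<m agree a<fa fa<ga)
        excedance (tri≈ _ fa≡ga _) = fa≡ga
        excedance (tri> _ _ ga<fa) = ⊥-elim (no-larger-excedance G F g⇒f f⇒g a<m (sym ∘′ agree) (f⇒g a<h a<fa) ga<fa)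
      ... | tri≈ _ a≡fa _ = at-fixed-point a<h (sym a≡fa)
      ... | tri> _ _ fa<a = sym (agree-at-deficiency F G a<m agree fa<a)

does≡true⇒ : ∀ {A : Set} (a? : Dec A) → does a? ≡ true → A
does≡true⇒ (yes a) _ = a

vec-ext : ∀ {A : Set} {k} {u v : Vec A k} → (∀ i → lookup u i ≡ lookup v i) → u ≡ v
vec-ext {u = u} {v} same = trans (sym (tabulate∘lookup u)) (trans (tabulate-cong same) (tabulate∘lookup v))

at-lookup : ∀ {m} (π : Word m) (i : Fin m) → at π (toℕ i) ≡ toℕ (lookup π i)
at-lookup {m} π i with toℕ i <? m
... | yes i<m = cong (λ j → toℕ (lookup π j)) (fromℕ<-toℕ i i<m)
... | no  i≮m = ⊥-elim (i≮m (toℕ<n i))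

at-fromℕ< : ∀ {m} (π : Word m) {a} (a<m : a < m) → at π a ≡ toℕ (lookup π (fromℕ< a<m))
at-fromℕ< π a<m = trans (cong (at π) (sym (toℕ-fromℕ< a<m))) (at-lookup π (fromℕ< a<m))

module _ {m : ℕ} {π : Word m} where

  IsCI321⇒map : IsCI321 π → IsCI321Map m (at π)
  IsCI321⇒map (inv , centro , avoid) = record
    { bounded         = λ a<m → subst (_< m) (sym (at-fromℕ< π a<m)) (toℕ<n _)
    ; involutive      = involutive
    ; centrosymmetric = centrosymmetric
    ; avoids-321      = avoids-321
    }
    where
    toℕ-fromℕ<⁻¹ : ∀ {a} (a<m : a < m) → a ≡ toℕ (fromℕ< a<m)
    toℕ-fromℕ<⁻¹ a<m = sym (toℕ-fromℕ< a<m)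

    involutive : ∀ {a} → a < m → at π (at π a) ≡ a
    involutive a<m = trans (cong (at π) (at-fromℕ< π a<m))
                           (trans (at-lookup π _) (trans (cong toℕ (inv _)) (toℕ-fromℕ< a<m)))

    centrosymmetric : ∀ {a} → a < m → at π a + at π (m ∸ suc a) ≡ m ∸ 1
    centrosymmetric {a} a<m = trans (cong₂ _+_ (at-fromℕ< π a<m) (trans (cong (at π) opposite-a) (at-lookup π _)))
                                    (centro (fromℕ< a<m))
      where
      opposite-a : m ∸ suc a ≡ toℕ (opposite (fromℕ< a<m))
      opposite-a = sym (trans (opposite-prop (fromℕ< a<m)) (cong (λ x → m ∸ suc x) (toℕ-fromℕ< a<m)))

    avoids-321 : ∀ {i j k} → i < j → j < k → k < m → at π j < at π i → at π k < at π j → ⊥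
    avoids-321 {i} {j} {k} i<j j<k k<m πj<πi πk<πj = avoid (fromℕ< i<m) (fromℕ< j<m) (fromℕ< k<m)
      ( subst₂ _<_ (toℕ-fromℕ<⁻¹ i<m) (toℕ-fromℕ<⁻¹ j<m) i<j
      , subst₂ _<_ (toℕ-fromℕ<⁻¹ j<m) (toℕ-fromℕ<⁻¹ k<m) j<k
      , subst₂ _<_ (at-fromℕ< π j<m) (at-fromℕ< π i<m) πj<πi
      , subst₂ _<_ (at-fromℕ< π k<m) (at-fromℕ< π j<m) πk<πj )
      where
      j<m : j < m
      j<m = <-trans j<k k<m
      i<m : i < m
      i<m = <-trans i<j j<m

  map⇒IsCI321 : ∀ {f} → IsCI321Map m f → (∀ i → toℕ (lookup π i) ≡ f (toℕ i)) → IsCI321 π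
  map⇒IsCI321 {f} F π≡f = inv , centro , avoid
    where
    module F = IsCI321Map F
    inv : IsInvolution π
    inv i = toℕ-injective (trans (π≡f _) (trans (cong f (π≡f i)) (F.involutive (toℕ<n i))))
    centro : IsCentrosymmetric π
    centro i = trans (cong₂ _+_ (π≡f i) (trans (π≡f (opposite i)) (cong f (opposite-prop i))))
                     (F.centrosymmetric (toℕ<n i))
    avoid : Avoids321 π
    avoid i j k (i<j , j<k , πj<πi , πk<πj) =
      F.avoids-321 i<j j<k (toℕ<n k) (subst₂ _<_ (π≡f j) (π≡f i) πj<πi) (subst₂ _<_ (π≡f k) (π≡f j) πk<πj)

decode : ∀ {n} → Vec Bool n → Word (2 * n)
decode c = tabulate (λ i → fromℕ< (Decode.partner-< c (toℕ<n i)))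

encode : ∀ {n} → Word (2 * n) → Vec Bool n
encode {n} π = tabulateBits (λ a → does (a <? at π a)) n

module _ {n : ℕ} (c : Vec Bool n) where
  open Decode c

  lookup-decode : ∀ i → toℕ (lookup (decode c) i) ≡ partner (toℕ i)
  lookup-decode i = trans (cong toℕ (lookup∘tabulate _ i)) (toℕ-fromℕ< _)

  at-decode : ∀ {a} → a < m → at (decode c) a ≡ partner a
  at-decode a<m = trans (at-fromℕ< (decode c) a<m) (trans (lookup-decode _) (cong partner (toℕ-fromℕ< a<m)))

  partner-IsCI321Map : IsCI321Map m partner
  partner-IsCI321Map = record
    { bounded         = partner-<
    ; involutive      = partner-involutive
    ; centrosymmetric = partner-centrosymmetric
    ; avoids-321      = partner-avoids-321
    }

  decode-IsCI321 : IsCI321 (decode c)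
  decode-IsCI321 = map⇒IsCI321 {π = decode c} partner-IsCI321Map lookup-decode

encode-decode : ∀ {n} (c : Vec Bool n) → encode {n} (decode c) ≡ c
encode-decode {n} c = bit-ext λ {a} a<n →
  trans (bit-tabulateBits _ a<n) (trans (cong (λ x → does (a <? x)) (at-decode c (lower<m a<n))) (by (bit c a) refl a<n))
  where
  open Decode c
  by : ∀ {a} b → bit c a ≡ b → a < n → does (a <? partner a) ≡ b
  by {a} true  e a<n = dec-true (a <? partner a) (bit⇒excedance a<n e)
  by {a} false e a<n = dec-false (a <? partner a) λ a<pa → case trans (sym e) (excedance⇒bit a<n a<pa) of λ ()

decode-encode : ∀ {n} {π : Word (2 * n)} → IsCI321 π → decode (encode {n} π) ≡ π
decode-encode {n} {π} ci = vec-ext λ i → toℕ-injective (begin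
  toℕ (lookup (decode c) i)   ≡⟨ lookup-decode c i ⟩
  partner (toℕ i)             ≡⟨ ExcedanceDetermined.excedance-determined m≡n+n
                                   (partner-IsCI321Map c) (IsCI321⇒map ci) partner⇒π π⇒partner (toℕ<n i) ⟩
  at π (toℕ i)                ≡⟨ at-lookup π i ⟩
  toℕ (lookup π i)            ∎)
  where
  open ≡-Reasoning
  c = encode {n} π
  open Decode c
  bit-c : ∀ {a} → a < n → bit c a ≡ does (a <? at π a)
  bit-c = bit-tabulateBits _
  partner⇒π : ∀ {a} → a < n → a < partner a → a < at π a
  partner⇒π a<n a<pa = does≡true⇒ (_ <? _) (trans (sym (bit-c a<n)) (excedance⇒bit a<n a<pa))
  π⇒partner : ∀ {a} → a < n → a < at π a → a < partner a
  π⇒partner a<n a<πa = bit⇒excedance a<n (trans (bit-c a<n) (dec-true (_ <? _) a<πa))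

positions : ℕ → List ℕ
positions n = map suc (upTo n)

positions-suc : ∀ n → positions (suc n) ≡ positions n ++ [ suc n ]
positions-suc n = trans (cong (map suc) (sym (upTo-∷ʳ n))) (map-++ suc (upTo n) [ n ])

filter-cong-All : ∀ {A : Set} {P Q : Pred A 0ℓ} (P? : Decidable P) (Q? : Decidable Q) {xs} →
  All (λ x → (P x → Q x) × (Q x → P x)) xs → filter P? xs ≡ filter Q? xs
filter-cong-All P? Q? []                      = refl
filter-cong-All P? Q? {x ∷ _} ((to , from) ∷ rest) with P? x | Q? x
... | yes _  | yes _  = cong (x ∷_) (filter-cong-All P? Q? rest)
... | no  _  | no  _  = filter-cong-All P? Q? rest
... | yes Px | no ¬Qx = ⊥-elim (¬Qx (to Px))
... | no ¬Px | yes Qx = ⊥-elim (¬Px (from Qx))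

filter-positions-cong : ∀ {n} {P Q : Pred ℕ 0ℓ} (P? : Decidable P) (Q? : Decidable Q) →
  (∀ {a} → a < n → (P (suc a) → Q (suc a)) × (Q (suc a) → P (suc a))) →
  filter P? (positions n) ≡ filter Q? (positions n)
filter-positions-cong {n} P? Q? same = filter-cong-All P? Q? (map⁺ (applyUpTo⁺₁ _ n same))

filter-singleton : ∀ {P : Pred ℕ 0ℓ} (P? : Decidable P) x → filter P? [ x ] ≡ (if does (P? x) then [ x ] else [])
filter-singleton P? x with does (P? x)
... | true  = refl
... | false = refl

DescentAt? : ∀ {k} (c : Vec Bool k) → Decidable (λ i → descentAt c (i ∸ 1) ≡ true)
DescentAt? c i = descentAt c (i ∸ 1) Bool.≟ true

-- The descent positions within 1..n of the word c followed by the bit e.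
descents : ∀ {n} → Bool → Vec Bool n → List ℕ
descents e []                = []
descents {suc n} e (b ∷ c)   = descents b c ++ (if b ∧ not e then [ suc n ] else [])

filter-descents : ∀ {n} e (c : Vec Bool n) → filter (DescentAt? (e ∷ c)) (positions n) ≡ descents e c
filter-descents e []                = refl
filter-descents {suc n} e (b ∷ c)   = begin
  filter (DescentAt? (e ∷ b ∷ c)) (positions (suc n))
    ≡⟨ cong (filter _) (positions-suc n) ⟩
  filter (DescentAt? (e ∷ b ∷ c)) (positions n ++ [ suc n ])
    ≡⟨ filter-++ _ (positions n) [ suc n ] ⟩
  filter (DescentAt? (e ∷ b ∷ c)) (positions n) ++ filter (DescentAt? (e ∷ b ∷ c)) [ suc n ]
    ≡⟨ cong₂ _++_ (trans (filter-positions-cong _ _ earlier) (filter-descents b c))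
                  (filter-singleton (DescentAt? (e ∷ b ∷ c)) (suc n)) ⟩
  descents b c ++ (if does (descentAt (e ∷ b ∷ c) n Bool.≟ true) then [ suc n ] else [])
    ≡⟨ cong (λ x → descents b c ++ (if x then [ suc n ] else [])) last ⟩
  descents b c ++ (if b ∧ not e then [ suc n ] else [])
    ∎
  where
  open ≡-Reasoning
  earlier : ∀ {a} → a < n → (descentAt (e ∷ b ∷ c) a ≡ true → descentAt (b ∷ c) a ≡ true)
                            × (descentAt (b ∷ c) a ≡ true → descentAt (e ∷ b ∷ c) a ≡ true)
  earlier {a} a<n = trans (sym same) , trans same
    where
    same : descentAt (e ∷ b ∷ c) a ≡ descentAt (b ∷ c) a
    same = cong₂ (λ x y → x ∧ not y) (bit-init e (b ∷ c) (m<n⇒m<1+n a<n))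
                                      (bit-init e (b ∷ c) (s≤s a<n))
  does-≟true : ∀ x → does (x Bool.≟ true) ≡ x
  does-≟true true  = refl
  does-≟true false = refl
  last : does (descentAt (e ∷ b ∷ c) n Bool.≟ true) ≡ b ∧ not e
  last = trans (does-≟true _) (cong₂ (λ x y → x ∧ not y) (trans (bit-init e (b ∷ c) (n<1+n n)) (bit-last b c))
                                                         (bit-last e (b ∷ c)))

-- Enumeration

concatMap-map : ∀ {A B C : Set} (f : A → B → C) xs ys →
  concatMap (λ x → map (f x) ys) xs ≡ cartesianProductWith f xs ys
concatMap-map f []       ys = refl
concatMap-map f (x ∷ xs) ys = cong (map (f x) ys ++_) (concatMap-map f xs ys)

allWords-suc : ∀ m k → allWords m (suc k) ≡ cartesianProductWith (λ w x → x ∷ w) (allWords m k) (allFin m)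
allWords-suc m k = concatMap-map (λ w x → x ∷ w) (allWords m k) (allFin m)

allWords-complete : ∀ m k (w : Vec (Fin m) k) → w ∈ allWords m k
allWords-complete m zero    []      = here refl
allWords-complete m (suc k) (x ∷ w) = subst (_ ∈_) (sym (allWords-suc m k))
  (∈-cartesianProductWith⁺ (λ w x → x ∷ w) (allWords-complete m k w) (∈-allFin x))

allWords-unique : ∀ m k → Unique (allWords m k)
allWords-unique m zero    = [] ∷ []
allWords-unique m (suc k) = subst Unique (sym (allWords-suc m k))
  (Unique.cartesianProductWith⁺ (λ w x → x ∷ w) (λ { refl → refl , refl }) (allWords-unique m k) (Unique.allFin⁺ m))

codes : (n : ℕ) → List (Vec Bool n)
codes zero    = [ [] ]
codes (suc n) = map (false ∷_) (codes n) ++ map (true ∷_) (codes n)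

codes-complete : ∀ {n} (c : Vec Bool n) → c ∈ codes n
codes-complete []          = here refl
codes-complete (false ∷ c) = ∈-++⁺ˡ (∈-map⁺ (false ∷_) (codes-complete c))
codes-complete (true ∷ c)  = ∈-++⁺ʳ (map (false ∷_) (codes _)) (∈-map⁺ (true ∷_) (codes-complete c))

codes-unique : ∀ n → Unique (codes n)
codes-unique zero    = [] ∷ []
codes-unique (suc n) = Unique.++⁺ (Unique.map⁺ (λ { refl → refl }) (codes-unique n))
                                  (Unique.map⁺ (λ { refl → refl }) (codes-unique n)) different-heads
  where
  different-heads : ∀ {v} → ¬ (v ∈ map (false ∷_) (codes n) × v ∈ map (true ∷_) (codes n))
  different-heads (v∈₀ , v∈₁) with ∈-map⁻ (false ∷_) v∈₀ | ∈-map⁻ (true ∷_) v∈₁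
  ... | _ , _ , refl | _ , _ , ()

decode-injective : ∀ {n} {c c′ : Vec Bool n} → decode c ≡ decode c′ → c ≡ c′
decode-injective {n} {c} {c′} e = trans (sym (encode-decode c)) (trans (cong (encode {n}) e) (encode-decode c′))

ICI321↭decoded-codes : ∀ n → ICI321 (2 * n) ↭ map (decode {n}) (codes n)
ICI321↭decoded-codes n = ∼bag⇒↭ (unique∧set⇒bag
  (Unique.filter⁺ IsCI321? (allWords-unique (2 * n) (2 * n)))
  (Unique.map⁺ decode-injective (codes-unique n))
  (mk⇔ decoded decodes-into))
  where
  decoded : ∀ {π} → π ∈ ICI321 (2 * n) → π ∈ map (decode {n}) (codes n)
  decoded {π} π∈ = subst (_∈ map (decode {n}) (codes n))
    (decode-encode {n} (proj₂ (∈-filter⁻ IsCI321? {xs = allWords (2 * n) (2 * n)} π∈)))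
    (∈-map⁺ (decode {n}) (codes-complete (encode {n} π)))
  decodes-into : ∀ {π} → π ∈ map (decode {n}) (codes n) → π ∈ ICI321 (2 * n)
  decodes-into π∈ with ∈-map⁻ (decode {n}) π∈
  ... | c , _ , refl = ∈-filter⁺ IsCI321? (allWords-complete (2 * n) (2 * n) (decode c)) (decode-IsCI321 c)

module _ {A : Set} (s : A → ℕ) where

  genPoly-↭ : ∀ {xs ys} → xs ↭ ys → ∀ k → genPoly s xs k ≡ genPoly s ys k
  genPoly-↭ xs↭ys k = cong ℤ.+_ (↭-length (filter-↭ (λ x → s x ≟ k) xs↭ys))

  genPoly-++ : ∀ xs ys k → genPoly s (xs ++ ys) k ≡ genPoly s xs k +ℤ genPoly s ys k
  genPoly-++ xs ys k = trans (cong (ℤ.+_ ∘ length) (filter-++ (λ x → s x ≟ k) xs ys))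
                             (trans (cong ℤ.+_ (length-++ (filter _ xs))) (pos-+ (length (filter (λ x → s x ≟ k) xs)) _))

  genPoly-cong : ∀ {t : A → ℕ} → (∀ x → s x ≡ t x) → ∀ xs k → genPoly s xs k ≡ genPoly t xs k
  genPoly-cong s≡t xs k = cong (ℤ.+_ ∘ length)
    (filter-≐ (λ x → s x ≟ k) (λ x → _ ≟ k) ((λ {x} → trans (sym (s≡t x))) , (λ {x} → trans (s≡t x))) xs)

  genPoly-shift : ∀ j xs k → genPoly (λ x → j + s x) xs k ≡ (q^ j ⊗ genPoly s xs) k
  genPoly-shift j xs k with j ≤? k
  ... | yes j≤k = cong (ℤ.+_ ∘ length) (filter-≐ (λ x → j + s x ≟ k) (λ x → s x ≟ k ∸ j)
                    ( (λ {x} e → trans (sym (m+n∸m≡n j (s x))) (cong (_∸ j) e))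
                    , (λ e → trans (cong (λ y → j + y) e) (m+[n∸m]≡n j≤k)) ) xs)
  ... | no  j≰k = cong (ℤ.+_ ∘ length) (filter-none (λ x → j + s x ≟ k)
                    (universal (λ x e → j≰k (subst (j ≤_) e (m≤m+n j (s x)))) xs))

genPoly-map : ∀ {A B : Set} (s : B → ℕ) (g : A → B) xs k → genPoly s (map g xs) k ≡ genPoly (s ∘ g) xs k
genPoly-map s g xs k = cong ℤ.+_ (length-filter-map xs)
  where
  length-filter-map : ∀ xs → length (filter (λ y → s y ≟ k) (map g xs)) ≡ length (filter (λ x → s (g x) ≟ k) xs)
  length-filter-map []       = refl
  length-filter-map (x ∷ xs) with does (s (g x) ≟ k)
  ... | true  = cong suc (length-filter-map xs)
  ... | false = length-filter-map xs

genPoly-codes-suc : ∀ {n} (s : Vec Bool (suc n) → ℕ) k →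
  genPoly s (codes (suc n)) k ≡ genPoly (s ∘ (false ∷_)) (codes n) k +ℤ genPoly (s ∘ (true ∷_)) (codes n) k
genPoly-codes-suc {n} s k = trans (genPoly-++ s (map (false ∷_) (codes n)) _ k)
  (cong₂ _+ℤ_ (genPoly-map s (false ∷_) (codes n) k) (genPoly-map s (true ∷_) (codes n) k))

⊗-cong : ∀ {f g : Poly} → (∀ k → f k ≡ g k) → ∀ j k → (q^ j ⊗ f) k ≡ (q^ j ⊗ g) k
⊗-cong f≡g j k with j ≤? k
... | yes _ = f≡g (k ∸ j)
... | no  _ = refl

⊗-⊖ : ∀ (f g : Poly) j k → (q^ j ⊗ (f ⊖ g)) k ≡ (q^ j ⊗ f) k - (q^ j ⊗ g) k
⊗-⊖ f g j k with j ≤? k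
... | yes _ = refl
... | no  _ = refl

-- The recurrences

des maj : ∀ {n} → Bool → Vec Bool n → ℕ
des e c = length (descents e c)
maj e c = sum (descents e c)

descents-after-0 : ∀ {n} e (c : Vec Bool n) → descents e (false ∷ c) ≡ descents false c
descents-after-0 e c = ++-identityʳ _

descents-11 : ∀ {n} (c : Vec Bool n) → descents true (true ∷ c) ≡ descents true c
descents-11 c = ++-identityʳ _

Des⁺-decode : ∀ {n} (c : Vec Bool n) → Des⁺ n (decode c) ≡ descents false c
Des⁺-decode {n} c = trans (filter-positions-cong _ (DescentAt? (false ∷ c)) same) (filter-descents false c)
  where
  open Decode c
  descentAt-0 : ∀ a → descentAt (false ∷ c) a ≡ descentAt c a
  descentAt-0 a = cong₂ (λ x y → x ∧ not y) (bit-false c a) (bit-false c (suc a))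
  same : ∀ {a} → a < n →
         (at (decode c) (suc a) < at (decode c) a → descentAt (false ∷ c) a ≡ true)
       × (descentAt (false ∷ c) a ≡ true → at (decode c) (suc a) < at (decode c) a)
  same {a} a<n =
      (λ desc → trans (descentAt-0 a) (descent⇒code a<n (subst₂ _<_ at-suc-a at-a desc)))
    , (λ code → subst₂ _<_ (sym at-suc-a) (sym at-a) (code⇒descent a<n (trans (sym (descentAt-0 a)) code)))
    where
    at-a : at (decode c) a ≡ partner a
    at-a = at-decode c (lower<m a<n)
    at-suc-a : at (decode c) (suc a) ≡ partner (suc a)
    at-suc-a = at-decode c (lower-suc<m a<n)

d≡ : ∀ n k → d n k ≡ genPoly (des false) (codes n) k
d≡ n k = begin
  genPoly (des⁺ n) (ICI321 (2 * n)) k                ≡⟨ genPoly-↭ (des⁺ n) (ICI321↭decoded-codes n) k ⟩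
  genPoly (des⁺ n) (map (decode {n}) (codes n)) k    ≡⟨ genPoly-map (des⁺ n) decode (codes n) k ⟩
  genPoly (des⁺ n ∘ decode) (codes n) k              ≡⟨ genPoly-cong _ (cong length ∘ Des⁺-decode) (codes n) k ⟩
  genPoly (des false) (codes n) k                    ∎
  where open ≡-Reasoning

p≡ : ∀ n k → p n k ≡ genPoly (maj false) (codes n) k
p≡ n k = begin
  genPoly (maj⁺ n) (ICI321 (2 * n)) k                ≡⟨ genPoly-↭ (maj⁺ n) (ICI321↭decoded-codes n) k ⟩
  genPoly (maj⁺ n) (map (decode {n}) (codes n)) k    ≡⟨ genPoly-map (maj⁺ n) decode (codes n) k ⟩
  genPoly (maj⁺ n ∘ decode) (codes n) k              ≡⟨ genPoly-cong _ (cong sum ∘ Des⁺-decode) (codes n) k ⟩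
  genPoly (maj false) (codes n) k                    ∎
  where open ≡-Reasoning

-- The contributions of the codes ending in 1 to d (suc n) and p (suc n).
desTail majTail : ℕ → Poly
desTail n = genPoly (λ c → 1 + des true c) (codes n)
majTail n = genPoly (λ c → suc n + maj true c) (codes n)

d-suc : ∀ n k → d (suc n) k ≡ d n k +ℤ desTail n k
d-suc n k = begin
  d (suc n) k                                    ≡⟨ d≡ (suc n) k ⟩
  genPoly (des false) (codes (suc n)) k          ≡⟨ genPoly-codes-suc {n} (des false) k ⟩
  genPoly (des false ∘ (false ∷_)) (codes n) k +ℤ genPoly (des false ∘ (true ∷_)) (codes n) k
    ≡⟨ cong₂ _+ℤ_ (genPoly-cong _ (cong length ∘ descents-after-0 false) (codes n) k)
                  (genPoly-cong _ (λ c → trans (length-++ (descents true c)) (+-comm _ 1)) (codes n) k) ⟩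
  genPoly (des false) (codes n) k +ℤ desTail n k  ≡⟨ cong (_+ℤ desTail n k) (sym (d≡ n k)) ⟩
  d n k +ℤ desTail n k                           ∎
  where open ≡-Reasoning

desTail-suc : ∀ n k → desTail (suc n) k ≡ (q^ 1 ⊗ d n) k +ℤ desTail n k
desTail-suc n k = begin
  desTail (suc n) k                              ≡⟨ genPoly-codes-suc {n} (λ c → 1 + des true c) k ⟩
  genPoly (λ c → 1 + des true (false ∷ c)) (codes n) k +ℤ genPoly (λ c → 1 + des true (true ∷ c)) (codes n) k
    ≡⟨ cong₂ _+ℤ_ (genPoly-cong _ (cong (suc ∘ length) ∘ descents-after-0 true) (codes n) k)
                  (genPoly-cong _ (cong (suc ∘ length) ∘ descents-11) (codes n) k) ⟩
  genPoly (λ c → 1 + des false c) (codes n) k +ℤ desTail n k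
    ≡⟨ cong (_+ℤ desTail n k) (trans (genPoly-shift (des false) 1 (codes n) k) (⊗-cong (sym ∘ d≡ n) 1 k)) ⟩
  (q^ 1 ⊗ d n) k +ℤ desTail n k                  ∎
  where open ≡-Reasoning

p-suc : ∀ n k → p (suc n) k ≡ p n k +ℤ majTail n k
p-suc n k = begin
  p (suc n) k                                    ≡⟨ p≡ (suc n) k ⟩
  genPoly (maj false) (codes (suc n)) k          ≡⟨ genPoly-codes-suc {n} (maj false) k ⟩
  genPoly (maj false ∘ (false ∷_)) (codes n) k +ℤ genPoly (maj false ∘ (true ∷_)) (codes n) k
    ≡⟨ cong₂ _+ℤ_ (genPoly-cong _ (cong sum ∘ descents-after-0 false) (codes n) k)
                  (genPoly-cong _ last-descent (codes n) k) ⟩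
  genPoly (maj false) (codes n) k +ℤ majTail n k  ≡⟨ cong (_+ℤ majTail n k) (sym (p≡ n k)) ⟩
  p n k +ℤ majTail n k                           ∎
  where
  open ≡-Reasoning
  last-descent : ∀ c → maj false (true ∷ c) ≡ suc n + maj true c
  last-descent c = trans (sum-++ (descents true c) [ suc n ])
                         (trans (cong (maj true c +_) (+-identityʳ (suc n))) (+-comm (maj true c) (suc n)))

majTail-suc : ∀ n k → majTail (suc n) k ≡ (q^ suc (suc n) ⊗ p n) k +ℤ (q^ 1 ⊗ majTail n) k
majTail-suc n k = begin
  majTail (suc n) k                              ≡⟨ genPoly-codes-suc {n} (λ c → suc (suc n) + maj true c) k ⟩
  genPoly (λ c → suc (suc n) + maj true (false ∷ c)) (codes n) k
    +ℤ genPoly (λ c → suc (suc n) + maj true (true ∷ c)) (codes n) k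
    ≡⟨ cong₂ _+ℤ_ (genPoly-cong _ (cong (λ l → suc (suc n) + sum l) ∘ descents-after-0 true) (codes n) k)
                  (genPoly-cong _ (cong (λ l → suc (suc n) + sum l) ∘ descents-11) (codes n) k) ⟩
  genPoly (λ c → suc (suc n) + maj false c) (codes n) k +ℤ genPoly (λ c → 1 + (suc n + maj true c)) (codes n) k
    ≡⟨ cong₂ _+ℤ_ (trans (genPoly-shift (maj false) (suc (suc n)) (codes n) k)
                         (⊗-cong (sym ∘ p≡ n) (suc (suc n)) k))
                  (genPoly-shift (λ c → suc n + maj true c) 1 (codes n) k) ⟩
  (q^ suc (suc n) ⊗ p n) k +ℤ (q^ 1 ⊗ majTail n) k ∎
  where open ≡-Reasoning

rearrange : ∀ x u v w → x +ℤ (u +ℤ (v - w)) ≡ (x +ℤ v) +ℤ (u - w)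
rearrange = solve 4 (λ x u v w → x :+ (u :+ (v :- w)) := (x :+ v) :+ (u :- w)) refl
  where open +-*-Solver

difference : ∀ {x y z} → x ≡ y +ℤ z → z ≡ x - y
difference {y = y} {z} x≡y+z = trans (solve 2 (λ y z → z := (y :+ z) :- y) refl y z) (cong (_- y) (sym x≡y+z))
  where open +-*-Solver

desTail≡ : ∀ n k → desTail n k ≡ d (suc n) k - d n k
desTail≡ n k = difference {y = d n k} (d-suc n k)

majTail≡ : ∀ n k → majTail n k ≡ (p (suc n) ⊖ p n) k
majTail≡ n k = difference {y = p n k} (p-suc n k)

lemma3p7 : ∀ (n : ℕ) → 2 ≤ n → ∀ (k : ℕ) →
    (d n k ≡ ((d (n ∸ 1) ⊕ d (n ∸ 1)) ⊕ ((q^ 1 ⊗ d (n ∸ 2)) ⊖ d (n ∸ 2))) k)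
    × (p n k ≡ ((p (n ∸ 1) ⊕ (q^ 1 ⊗ p (n ∸ 1))) ⊕ ((q^ n ⊗ p (n ∸ 2)) ⊖ (q^ 1 ⊗ p (n ∸ 2)))) k)
lemma3p7 (suc (suc n)) (s≤s (s≤s z≤n)) k = d-recurrence , p-recurrence
  where
  open ≡-Reasoning
  d₀ d₁ : ℤ
  d₀ = d n k
  d₁ = d (1 + n) k

  d-recurrence : d (2 + n) k ≡ ((d (1 + n) ⊕ d (1 + n)) ⊕ ((q^ 1 ⊗ d n) ⊖ d n)) k
  d-recurrence = begin
    d (2 + n) k                                ≡⟨ d-suc (suc n) k ⟩
    d₁ +ℤ desTail (1 + n) k                    ≡⟨ cong (d₁ +ℤ_) (desTail-suc n k) ⟩
    d₁ +ℤ ((q^ 1 ⊗ d n) k +ℤ desTail n k)      ≡⟨ cong (λ t → d₁ +ℤ ((q^ 1 ⊗ d n) k +ℤ t)) (desTail≡ n k) ⟩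
    d₁ +ℤ ((q^ 1 ⊗ d n) k +ℤ (d₁ - d₀))        ≡⟨ rearrange d₁ ((q^ 1 ⊗ d n) k) d₁ d₀ ⟩
    (d₁ +ℤ d₁) +ℤ ((q^ 1 ⊗ d n) k - d₀)        ∎

  p-recurrence : p (2 + n) k ≡ ((p (1 + n) ⊕ (q^ 1 ⊗ p (1 + n))) ⊕ ((q^ (2 + n) ⊗ p n) ⊖ (q^ 1 ⊗ p n))) k
  p-recurrence = begin
    p (2 + n) k
      ≡⟨ p-suc (suc n) k ⟩
    p (1 + n) k +ℤ majTail (1 + n) k
      ≡⟨ cong (p (1 + n) k +ℤ_) (majTail-suc n k) ⟩
    p (1 + n) k +ℤ ((q^ (2 + n) ⊗ p n) k +ℤ (q^ 1 ⊗ majTail n) k)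
      ≡⟨ cong (λ t → p (1 + n) k +ℤ ((q^ (2 + n) ⊗ p n) k +ℤ t))
              (trans (⊗-cong (majTail≡ n) 1 k) (⊗-⊖ (p (1 + n)) (p n) 1 k)) ⟩
    p (1 + n) k +ℤ ((q^ (2 + n) ⊗ p n) k +ℤ ((q^ 1 ⊗ p (1 + n)) k - (q^ 1 ⊗ p n) k))
      ≡⟨ rearrange (p (1 + n) k) ((q^ (2 + n) ⊗ p n) k) ((q^ 1 ⊗ p (1 + n)) k) ((q^ 1 ⊗ p n) k) ⟩
    (p (1 + n) k +ℤ (q^ 1 ⊗ p (1 + n)) k) +ℤ ((q^ (2 + n) ⊗ p n) k - (q^ 1 ⊗ p n) k)
      ∎
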